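{- For every finite tree $T$, we have $\operatorname{ind}(T) = \dim_{Bool}(T) = m(T)$.
   Context: Graphs are undirected without loops; a graph is $G=(V,E)$ with $E\subseteq [V]^2$, and $N_G(v)$ denotes the neighbourhood of $v$. For a set $X\subseteq V$, $K^V_X$ denotes the graph $(V,[X]^2)$ (a "clique"). The Boolean sum of a family of graphs $(G_i)_{i\in I}$ on the same vertex set $V$ is the graph on $V$ in which a pair $\{x,y\}$ of distinct vertices is an edge iff it is an edge of a finite and odd number of the $G_i$. The Boolean dimension $\dim_{Bool}(G)$ is the least cardinal $\kappa$ such that $G$ is the Boolean sum of a family of $\kappa$ cliques $K^V_{C_i}$, i.e. there are $\kappa$ subsets $C_i\subseteq V$ such that a pair of distinct vertices is an edge of $G$ iff it is contained in a finite and odd number of the $C_i$. A set $A\subseteq V$ is independent (mod 2) if for every finite nonempty $X\subseteq A$ there is $v\in V\setminus X$ such that $|N_G(v)\cap X|$ is odd; $\operatorname{ind}(G)$ is the maximum cardinality of an independent (mod 2) set. A star decomposition of a tree $T$ is a family $\Sigma=\{S_1,\dots,S_k\}$ of subtrees of $T$, each isomorphic to a star $K_{1,m}$ for some $m\ge 1$, pairwise edge-disjoint, such that every edge of $T$ is an edge of some $S_i$; $t(\Sigma)$ is the number of $S_i$ isomorphic to $K_{1,1}$ and $s(\Sigma)$ the number of $S_i$ isomorphic to $K_{1,m}$ with $m>1$. Then $m(T):=\min_\Sigma\,(t(\Sigma)+2s(\Sigma))$ over all star decompositions $\Sigma$ of $T$. -}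

module Defs where

open import Data.Nat using (ℕ; zero; suc; _+_; _*_; _≤_; _<_; _%_; _≡ᵇ_; _<ᵇ_)
open import Data.Bool using (Bool; true; false; if_then_else_; _∧_)
open import Data.Fin using (Fin; zero; suc; inject₁; fromℕ)
open import Data.Fin.Subset using (Subset; _∈_; _∉_; _⊆_; _∩_; ∣_∣; Nonempty)
open import Data.Vec using (tabulate; lookup)
open import Data.Product using (Σ; ∃; ∃-syntax; _×_; _,_)
open import Data.Sum using (_⊎_)
open import Relation.Binary.PropositionalEquality using (_≡_; _≢_)
open import Relation.Nullary using (¬_)
open import Function using (Injective; _⇔_)


record Graph (n : ℕ) : Set where
  field
    adj    : Fin n → Fin n → Bool
    sym    : ∀ x y → adj x y ≡ adj y x
    irrefl : ∀ x → adj x x ≡ false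

open Graph public

Edge : ∀ {n} → Graph n → Fin n → Fin n → Set
Edge G x y = adj G x y ≡ true

N : ∀ {n} → Graph n → Fin n → Subset n
N G v = tabulate (adj G v)

Odd : ℕ → Set
Odd m = m % 2 ≡ 1

count : ∀ {k} → (Fin k → Bool) → ℕ
count {zero}  p = 0
count {suc k} p = (if p zero then 1 else 0) + count (λ i → p (suc i))

data Walk {n} (G : Graph n) : Fin n → Fin n → Set where
  here : ∀ {v} → Walk G v v
  step : ∀ {u w v} → Edge G u w → Walk G w v → Walk G u v

Connected : ∀ {n} → Graph n → Set
Connected G = ∀ u v → Walk G u v

Cycle : ∀ {n} → Graph n → Set
Cycle {n} G = Σ ℕ λ k → Σ (Fin (3 + k) → Fin n) λ f →
    Injective _≡_ _≡_ f
  × (∀ (i : Fin (2 + k)) → Edge G (f (inject₁ i)) (f (suc i)))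
  × Edge G (f (fromℕ (2 + k))) (f zero)

Acyclic : ∀ {n} → Graph n → Set
Acyclic G = ¬ Cycle G

IsTree : ∀ {n} → Graph n → Set
IsTree {n} G = (0 < n) × Connected G × Acyclic G

IsBooleanSumOfCliques : ∀ {n k} → Graph n → (Fin k → Subset n) → Set
IsBooleanSumOfCliques {n} G C =
  ∀ (x y : Fin n) → x ≢ y →
    (Edge G x y ⇔ Odd (count (λ i → lookup (C i) x ∧ lookup (C i) y)))

IsBoolDim : ∀ {n} → Graph n → ℕ → Set
IsBoolDim {n} G d =
    (Σ (Fin d → Subset n) λ C → IsBooleanSumOfCliques G C)
  × (∀ k (C : Fin k → Subset n) → IsBooleanSumOfCliques G C → d ≤ k)

IndependentMod2 : ∀ {n} → Graph n → Subset n → Set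
IndependentMod2 {n} G A =
  ∀ (X : Subset n) → X ⊆ A → Nonempty X →
    ∃[ v ] (v ∉ X × Odd ∣ N G v ∩ X ∣)

IsInd : ∀ {n} → Graph n → ℕ → Set
IsInd {n} G d =
    (Σ (Subset n) λ A → IndependentMod2 G A × ∣ A ∣ ≡ d)
  × (∀ (A : Subset n) → IndependentMod2 G A → ∣ A ∣ ≤ d)

record StarFamily {n} (T : Graph n) (k : ℕ) : Set where
  field
    centre : Fin k → Fin n
    leaves : Fin k → Subset n

open StarFamily public

InStar : ∀ {n k} {T : Graph n} → StarFamily T k → Fin k → Fin n → Fin n → Set
InStar S i x y =
    (x ≡ centre S i × y ∈ leaves S i) ⊎ (y ≡ centre S i × x ∈ leaves S i)

IsStarDecomposition : ∀ {n k} (T : Graph n) → StarFamily T k → Set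
IsStarDecomposition {n} {k} T S =
    (∀ i → Nonempty (leaves S i))
  × (∀ i l → l ∈ leaves S i → Edge T (centre S i) l)
  × (∀ i j → i ≢ j → ∀ x y → InStar S i x y → ¬ InStar S j x y)
  × (∀ x y → Edge T x y → ∃[ i ] InStar S i x y)

tΣ : ∀ {n k} {T : Graph n} → StarFamily T k → ℕ
tΣ S = count (λ i → ∣ leaves S i ∣ ≡ᵇ 1)

sΣ : ∀ {n k} {T : Graph n} → StarFamily T k → ℕ
sΣ S = count (λ i → 1 <ᵇ ∣ leaves S i ∣)

IsM : ∀ {n} → Graph n → ℕ → Set
IsM {n} T d =
    (Σ ℕ λ k → Σ (StarFamily T k) λ S →
        IsStarDecomposition T S × tΣ S + 2 * sΣ S ≡ d)
  × (∀ k (S : StarFamily T k) → IsStarDecomposition T S → d ≤ tΣ S + 2 * sΣ S)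

module Submission where

-- Fix a forest T, a star decomposition Σ of T and put d = t(Σ) + 2 s(Σ).  A star with one leaf is a clique and
-- a larger star is the Boolean sum of two cliques (on its vertices and on its leaves), so dim_Bool(T) ≤ m(T) ≤ d.
-- An independent (mod 2) set A has at most k elements whenever T is the Boolean sum of k cliques: otherwise the
-- incidence vectors of the elements of A in GF(2)^k are linearly dependent, and a dependent set X ⊆ A makes
-- |N(v) ∩ X| even for every v ∉ X.  So ind(T) ≤ dim_Bool(T), and it suffices to build Σ together with an
-- independent set of size d.  By induction on the edges: the end l of a longest path is a leaf whose neighbour v
-- either carries a second leaf -- then the star of all edges at v costs 2, and v and l extend an independent set
-- of T without the edges at v -- or has at most one other neighbour -- then the edge lv costs 1, and v or l
-- extends an independent set of T without lv.

open import Defs renaming (sym to adj-sym)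
open import Algebra.Bundles using (CommutativeRing)
open import Data.Bool using (Bool; true; false; not; _∧_; _∨_; _xor_; if_then_else_)
import Data.Bool as Bool
open import Data.Bool.Properties
  using (xor-∧-commutativeRing; xor-assoc; xor-comm; xor-same; xor-identityʳ; ∧-comm; ∧-assoc; ∧-zeroʳ; ∧-identityʳ;
         ∧-distribˡ-xor; ∧-distribʳ-xor; ∨-identityʳ; ∨-zeroʳ; ¬-not)
open import Data.Fin using (Fin; zero; suc; splitAt; inject₁; fromℕ)
open import Data.Fin.Properties using (_≟_; any?; injective⇒≤)
open import Data.Nat using (ℕ; zero; suc; _+_; _*_; _≤_; _<_; _%_; _≡ᵇ_; _<ᵇ_; z≤n; s≤s)
open import Data.Nat.Tactic.RingSolver using (solve-∀)
open import Data.Nat.Properties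
  using (≤-refl; m≤m+n; suc-injective; ≤-trans; n≤1+n; <⇒≱; +-suc; <-trans; n<1+n; ≤-pred; _≤?_; ≰⇒>)
open import Data.List using (List; []; _∷_; length)
import Data.List as List
open import Data.List.Membership.Propositional using () renaming (_∈_ to _∈ₗ_; _∉_ to _∉ₗ_)
open import Data.List.Membership.Propositional.Properties using (∈-lookup)
open import Data.List.Relation.Unary.All using (All; []; _∷_)
import Data.List.Relation.Unary.All as All
open import Data.List.Relation.Unary.Any using (here; there)
open import Data.List.Relation.Unary.Linked using (Linked; []; [-]; _∷_)
import Data.List.Relation.Unary.Linked as Linked
open import Data.List.Relation.Unary.Unique.Propositional using (Unique)
open import Data.List.Relation.Unary.AllPairs using ([]; _∷_)
import Data.List.Relation.Unary.AllPairs as AllPairs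
open import Data.List.Relation.Unary.All.Properties using (¬Any⇒All¬)
open import Data.Product using (Σ; ∃; ∃-syntax; _×_; _,_; proj₁; proj₂; uncurry)
open import Data.Sum using (_⊎_; inj₁; inj₂; [_,_]′)
open import Data.Fin.Subset using (Subset; _∈_; _∉_; _⊆_; _∩_; ∣_∣; ⁅_⁆; Nonempty)
open import Data.Fin.Subset.Properties using (x∈⁅x⁆; x∈⁅y⁆⇒x≡y; ∣⁅x⁆∣≡1)
open import Data.Vec using ([]; _∷_; lookup; tabulate)
open import Data.Vec.Properties using (lookup∘tabulate; lookup-zipWith; lookup⇒[]=; []=⇒lookup)
open import Data.Vec.Functional using (Vector; tail; _++_)
open import Function using (_∘_; _⇔_; mk⇔; Equivalence)
open import Relation.Binary.PropositionalEquality
open import Relation.Nullary using (¬_; Dec; yes; no; does; _×-dec_; ¬?; contradiction)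
open import Relation.Nullary.Decidable using (dec-true; dec-false; decidable-stable)

open import Algebra.Properties.Semiring.Sum (CommutativeRing.semiring xor-∧-commutativeRing)
  using (sum; sum-cong-≗; sum-replicate-zero; ∑-distrib-+; ∑-comm; *-distribˡ-sum; *-distribʳ-sum)

private variable
  n k : ℕ

true≢false : true ≢ false
true≢false ()

∨-true : ∀ {a b} → a ∨ b ≡ true → a ≡ true ⊎ b ≡ true
∨-true {true}  _ = inj₁ refl
∨-true {false} e = inj₂ e

∧-true : ∀ {a b} → a ∧ b ≡ true → a ≡ true × b ≡ true
∧-true {true} e = refl , e

xor-cancelʳ : ∀ a b → (a xor b) xor b ≡ a
xor-cancelʳ a b = trans (xor-assoc a b b) (trans (cong (a xor_) (xor-same b)) (xor-identityʳ a))

sum-false : (f : Vector Bool n) → (∀ i → f i ≡ false) → sum f ≡ false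
sum-false {n} f f≡false = trans (sum-cong-≗ f≡false) (sum-replicate-zero n)

δ : Fin n → Vector Bool n
δ z u = does (u ≟ z)

δ≡true : {c x : Fin n} → δ c x ≡ true → x ≡ c
δ≡true {c = c} {x} e with x ≟ c | e
... | yes x≡c | _ = x≡c

infix 7 _·_
_·_ : Vector Bool n → Vector Bool n → Bool
X · h = sum (λ u → X u ∧ h u)

δ-· : (z : Fin n) (h : Vector Bool n) → δ z · h ≡ h z
δ-· {suc n} zero    h = trans (cong (h zero xor_) (sum-replicate-zero n)) (xor-identityʳ (h zero))
δ-· {suc n} (suc z) h = δ-· z (h ∘ suc)

·-distribʳ-xor : (X Y h : Vector Bool n) → (λ u → X u xor Y u) · h ≡ X · h xor Y · h
·-distribʳ-xor X Y h =
  trans (sum-cong-≗ (λ u → ∧-distribʳ-xor (h u) (X u) (Y u))) (∑-distrib-+ (λ u → X u ∧ h u) (λ u → Y u ∧ h u))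

·-xor-δ : (X : Vector Bool n) (s : Bool) (w : Fin n) (h : Vector Bool n) →
          (λ a → X a xor (s ∧ δ w a)) · h ≡ X · h xor (s ∧ h w)
·-xor-δ X s w h = begin
  (λ a → X a xor (s ∧ δ w a)) · h           ≡⟨ ·-distribʳ-xor X (λ a → s ∧ δ w a) h ⟩
  X · h xor sum (λ a → (s ∧ δ w a) ∧ h a)   ≡⟨ cong (X · h xor_) (sum-cong-≗ (λ a → ∧-assoc s (δ w a) (h a))) ⟩
  X · h xor sum (λ a → s ∧ (δ w a ∧ h a))   ≡⟨ cong (X · h xor_) (*-distribˡ-sum s (λ a → δ w a ∧ h a)) ⟨
  X · h xor (s ∧ δ w · h)                   ≡⟨ cong (λ t → X · h xor (s ∧ t)) (δ-· w h) ⟩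
  X · h xor (s ∧ h w)                       ∎
  where open ≡-Reasoning

sum-single : (f : Vector Bool n) (z : Fin n) → f z ≡ true → (∀ u → u ≢ z → f u ≡ false) → sum f ≡ true
sum-single f z fz others = trans (sum-cong-≗ f≡δ) (δ-· z (λ _ → true))
  where
  f≡δ : ∀ u → f u ≡ δ z u ∧ true
  f≡δ u with u ≟ z
  ... | yes refl = fz
  ... | no u≢z   = others u u≢z

sum-++ : ∀ {A : Set} {m} (h : A → Bool) (f : Vector A m) (g : Vector A n) →
         sum (h ∘ (f ++ g)) ≡ sum (h ∘ f) xor sum (h ∘ g)
sum-++ {m = zero}  h f g = refl
sum-++ {m = suc m} h f g = begin
  h (f zero) xor sum (λ i → h ((f ++ g) (suc i)))   ≡⟨ cong (h (f zero) xor_) (sum-cong-≗ (cong h ∘ ++-suc)) ⟩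
  h (f zero) xor sum (h ∘ (tail f ++ g))            ≡⟨ cong (h (f zero) xor_) (sum-++ h (tail f) g) ⟩
  h (f zero) xor (sum (h ∘ tail f) xor sum (h ∘ g)) ≡⟨ xor-assoc (h (f zero)) _ _ ⟨
  sum (h ∘ f) xor sum (h ∘ g)                       ∎
  where
  open ≡-Reasoning
  ++-suc : ∀ i → (f ++ g) (suc i) ≡ (tail f ++ g) i
  ++-suc i with splitAt m i
  ... | inj₁ _ = refl
  ... | inj₂ _ = refl

%2-suc : ∀ m b → m % 2 ≡ (if b then 1 else 0) → suc m % 2 ≡ (if not b then 1 else 0)
%2-suc 0 false _ = refl
%2-suc 1 true  _ = refl
%2-suc (suc (suc m)) b = %2-suc m b

count%2 : (p : Vector Bool n) → count p % 2 ≡ (if sum p then 1 else 0)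
count%2 {zero}  p = refl
count%2 {suc n} p with p zero
... | true  = %2-suc (count (p ∘ suc)) (sum (p ∘ suc)) (count%2 (p ∘ suc))
... | false = count%2 (p ∘ suc)

Odd-count⇔sum : (p : Vector Bool n) → Odd (count p) ⇔ sum p ≡ true
Odd-count⇔sum p = mk⇔ (λ odd → sum≡true (trans (sym (count%2 p)) odd))
                      (λ s → trans (count%2 p) (cong (λ b → if b then 1 else 0) s))
  where
  sum≡true : (if sum p then 1 else 0) ≡ 1 → sum p ≡ true
  sum≡true eq with sum p
  ... | true = refl

⇔-Odd⇒≡ : (b : Bool) (p : Vector Bool k) → (b ≡ true ⇔ Odd (count p)) → b ≡ sum p
⇔-Odd⇒≡ b p b⇔odd with b | sum p | Equivalence.to (Odd-count⇔sum p) | Equivalence.from (Odd-count⇔sum p)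
... | true  | true  | _  | _    = refl
... | false | false | _  | _    = refl
... | true  | false | to | _    = contradiction (to (Equivalence.to b⇔odd refl)) λ ()
... | false | true  | _  | from = Equivalence.from b⇔odd (from refl)

≡⇒⇔-Odd : (b : Bool) (p : Vector Bool k) → b ≡ sum p → (b ≡ true ⇔ Odd (count p))
≡⇒⇔-Odd b p b≡sum = mk⇔ (λ b≡true → Equivalence.from (Odd-count⇔sum p) (trans (sym b≡sum) b≡true))
                         (λ odd → trans b≡sum (Equivalence.to (Odd-count⇔sum p) odd))

_⊆ᵇ_ : Vector Bool n → Vector Bool n → Set
X ⊆ᵇ A = ∀ x → X x ≡ true → A x ≡ true

Inhabited : Vector Bool n → Set
Inhabited X = ∃ λ x → X x ≡ true

toggle : Vector Bool n → Fin n → Vector Bool n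
toggle X z u = X u xor δ z u

toggle-≡ : (X : Vector Bool n) (z : Fin n) → toggle X z z ≡ not (X z)
toggle-≡ X z rewrite dec-true (z ≟ z) refl = xor-comm (X z) true

toggle-≢ : (X : Vector Bool n) {z u : Fin n} → u ≢ z → toggle X z u ≡ X u
toggle-≢ X {z} {u} u≢z rewrite dec-false (u ≟ z) u≢z = xor-identityʳ (X u)

toggle≡true : (X : Vector Bool n) {z x : Fin n} → toggle X z x ≡ true → x ≡ z ⊎ X x ≡ true
toggle≡true X {z} {x} Yx = by-cases (x ≟ z)
  where
  by-cases : Dec (x ≡ z) → x ≡ z ⊎ X x ≡ true
  by-cases (yes x≡z) = inj₁ x≡z
  by-cases (no x≢z)  = inj₂ (trans (sym (toggle-≢ X x≢z)) Yx)

toggle-involutive : (X : Vector Bool n) (z u : Fin n) → toggle (toggle X z) z u ≡ X u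
toggle-involutive X z u = xor-cancelʳ (X u) (δ z u)

·-toggle : (X : Vector Bool n) (z : Fin n) (h : Vector Bool n) → toggle X z · h ≡ X · h xor h z
·-toggle X z h = trans (·-distribʳ-xor X (δ z) h) (cong (X · h xor_) (δ-· z h))

·-untoggle : (X : Vector Bool n) (z : Fin n) (h : Vector Bool n) → X · h ≡ toggle X z · h xor h z
·-untoggle X z h = trans (sym (xor-cancelʳ (X · h) (h z))) (cong (_xor h z) (sym (·-toggle X z h)))

⊆-toggle : {X A : Vector Bool n} {z : Fin n} → X ⊆ᵇ toggle A z → X z ≡ false → X ⊆ᵇ A
⊆-toggle {X = X} {A} {z} X⊆A Xz x Xx =
  trans (sym (toggle-≢ A (λ { refl → true≢false (trans (sym Xx) Xz) }))) (X⊆A x Xx)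

toggle-⊆ : (X : Vector Bool n) {z : Fin n} → X z ≡ true → toggle X z ⊆ᵇ X
toggle-⊆ X Xz x Yx = [ (λ { refl → Xz }) , (λ Xx → Xx) ]′ (toggle≡true X Yx)

toggle-⊆ᵇ : {X A : Vector Bool n} {z : Fin n} → X ⊆ᵇ A → A z ≡ true → toggle X z ⊆ᵇ A
toggle-⊆ᵇ {X = X} X⊆A Az x Yx = [ (λ { refl → Az }) , X⊆A x ]′ (toggle≡true X Yx)

count-cong : {f g : Vector Bool n} → (∀ i → f i ≡ g i) → count f ≡ count g
count-cong {zero}  f≗g = refl
count-cong {suc n} f≗g = cong₂ _+_ (cong (λ b → if b then 1 else 0) (f≗g zero)) (count-cong (f≗g ∘ suc))

count-∅ : count {n} (λ _ → false) ≡ 0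
count-∅ {zero}  = refl
count-∅ {suc n} = count-∅ {n}

count-toggle : (X : Vector Bool n) (z : Fin n) → X z ≡ false → count (toggle X z) ≡ suc (count X)
count-toggle {suc n} X zero    Xz rewrite Xz = cong suc (count-cong (xor-identityʳ ∘ X ∘ suc))
count-toggle {suc n} X (suc z) Xz with X zero
... | true  = cong suc (count-toggle (X ∘ suc) z Xz)
... | false = count-toggle (X ∘ suc) z Xz

count-untoggle : (X : Vector Bool n) (z : Fin n) → X z ≡ true → count X ≡ suc (count (toggle X z))
count-untoggle X z Xz = begin
  count X                        ≡⟨ count-cong (toggle-involutive X z) ⟨
  count (toggle (toggle X z) z)  ≡⟨ count-toggle (toggle X z) z (trans (toggle-≡ X z) (cong not Xz)) ⟩
  suc (count (toggle X z))       ∎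
  where open ≡-Reasoning

count-pos : (X : Vector Bool n) → 0 < count X → Inhabited X
count-pos {suc n} X 0<count with X zero in X0
... | true  = zero , X0
... | false = let x , Xx = count-pos (X ∘ suc) 0<count in suc x , Xx

count≡0 : (X : Vector Bool n) → count X ≡ 0 → ∀ x → X x ≡ false
count≡0 X count≡0 x = ¬-not (λ Xx → contradiction (trans (sym count≡0) (count-untoggle X x Xx)) λ ())

count≡1 : (X : Vector Bool n) → count X ≡ 1 → ∀ x y → x ≢ y → X x ∧ X y ≡ false
count≡1 X count≡1 x y x≢y with X x in Xx
... | false = refl
... | true  = trans (sym (toggle-≢ X (x≢y ∘ sym)))
                (count≡0 (toggle X x) (suc-injective (trans (sym (count-untoggle X x Xx)) count≡1)) y)

count-two : (X : Vector Bool n) {x y : Fin n} → X x ≡ true → X y ≡ true → x ≢ y → 2 ≤ count X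
count-two X {x} {y} Xx Xy x≢y =
  subst (2 ≤_) (sym (count-untoggle X x Xx))
    (s≤s (subst (1 ≤_) (sym (count-untoggle (toggle X x) y (trans (toggle-≢ X (x≢y ∘ sym)) Xy))) (s≤s z≤n)))

∣∣≡count : (S : Subset n) → ∣ S ∣ ≡ count (lookup S)
∣∣≡count []          = refl
∣∣≡count (true ∷ S)  = cong suc (∣∣≡count S)
∣∣≡count (false ∷ S) = ∣∣≡count S

-- Linear dependence over GF(2)

Vanishes : Vector Bool n → (Fin n → Vector Bool k) → Set
Vanishes {k = k} X f = ∀ (i : Fin k) → X · (λ a → f a i) ≡ false

LinearlyDependent : Vector Bool n → (Fin n → Vector Bool k) → Set
LinearlyDependent A f = ∃ λ X → X ⊆ᵇ A × Inhabited X × Vanishes X f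

eliminate : (Fin n → Vector Bool (suc k)) → Fin n → Fin n → Vector Bool k
eliminate f w a i = f a (suc i) xor (f a zero ∧ f w (suc i))

-- A vanishing combination X′ of the rows reduced by the pivot row w yields one of the original rows: add row w
-- exactly when X′ has first coordinate 1.
dependent-uneliminate : (f : Fin n → Vector Bool (suc k)) (A : Vector Bool n) (w : Fin n) →
                        A w ≡ true → f w zero ≡ true →
                        LinearlyDependent (toggle A w) (eliminate f w) → LinearlyDependent A f
dependent-uneliminate {n} f A w Aw fw (X′ , X′⊆A′ , (x , X′x) , vanishes′) =
  X , X⊆A , (x , trans (X≡X′ x≢w) X′x) , vanishes
  where
  open ≡-Reasoning
  s : Bool
  s = X′ · (λ a → f a zero)
  X : Vector Bool n
  X a = X′ a xor (s ∧ δ w a)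
  X≡X′ : ∀ {a} → a ≢ w → X a ≡ X′ a
  X≡X′ {a} a≢w rewrite dec-false (a ≟ w) a≢w | ∧-zeroʳ s = xor-identityʳ (X′ a)
  x≢w : x ≢ w
  x≢w refl with trans (sym (X′⊆A′ x X′x)) (trans (toggle-≡ A x) (cong not Aw))
  ... | ()
  X⊆A : X ⊆ᵇ A
  X⊆A a Xa = by-cases (a ≟ w)
    where
    by-cases : Dec (a ≡ w) → A a ≡ true
    by-cases (yes refl) = Aw
    by-cases (no a≢w)   = trans (sym (toggle-≢ A a≢w)) (X′⊆A′ a (trans (sym (X≡X′ a≢w)) Xa))
  vanishes : Vanishes X f
  vanishes zero = begin
    X · (λ a → f a zero)  ≡⟨ ·-xor-δ X′ s w (λ a → f a zero) ⟩
    s xor (s ∧ f w zero)  ≡⟨ cong (λ b → s xor (s ∧ b)) fw ⟩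
    s xor (s ∧ true)      ≡⟨ cong (s xor_) (∧-identityʳ s) ⟩
    s xor s               ≡⟨ xor-same s ⟩
    false                 ∎
  vanishes (suc i) = begin
    X · fᵢ                                                  ≡⟨ ·-xor-δ X′ s w fᵢ ⟩
    X′ · fᵢ xor (s ∧ f w (suc i))                           ≡⟨ cong (X′ · fᵢ xor_) (*-distribʳ-sum (f w (suc i)) (λ a → X′ a ∧ f a zero)) ⟩
    X′ · fᵢ xor sum (λ a → (X′ a ∧ f a zero) ∧ f w (suc i))  ≡⟨ cong (X′ · fᵢ xor_) (sum-cong-≗ (λ a → ∧-assoc (X′ a) _ _)) ⟩
    X′ · fᵢ xor X′ · (λ a → f a zero ∧ f w (suc i))          ≡⟨ ·-distribʳ-xor′ ⟨
    X′ · (λ a → eliminate f w a i)                          ≡⟨ vanishes′ i ⟩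
    false                                                   ∎
    where
    fᵢ : Vector Bool n
    fᵢ a = f a (suc i)
    ·-distribʳ-xor′ : X′ · (λ a → eliminate f w a i) ≡ X′ · fᵢ xor X′ · (λ a → f a zero ∧ f w (suc i))
    ·-distribʳ-xor′ = trans (sum-cong-≗ (λ a → ∧-distribˡ-xor (X′ a) _ _))
                                (∑-distrib-+ (λ a → X′ a ∧ fᵢ a) (λ a → X′ a ∧ (f a zero ∧ f w (suc i))))

linearlyDependent : (f : Fin n → Vector Bool k) (A : Vector Bool n) → k < count A → LinearlyDependent A f
linearlyDependent {k = zero} f A 0<count = A , (λ _ Ax → Ax) , count-pos A 0<count , λ ()
linearlyDependent {n} {suc k} f A k<count
  with any? (λ a → (A a Bool.≟ true) ×-dec (f a zero Bool.≟ true))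
... | yes (w , Aw , fw) =
  dependent-uneliminate f A w Aw fw
    (linearlyDependent (eliminate f w) (toggle A w) (≤-pred (subst (suc k <_) (count-untoggle A w Aw) k<count)))
... | no noPivot with linearlyDependent (tail ∘ f) A (<-trans (n<1+n k) k<count)
...   | X , X⊆A , inhabited , vanishes = X , X⊆A , inhabited , λ { zero → sum-false _ first≡false ; (suc i) → vanishes i }
  where
  first≡false : ∀ a → X a ∧ f a zero ≡ false
  first≡false a with X a in Xa
  ... | false = refl
  ... | true  = ¬-not (λ fa → noPivot (a , X⊆A a Xa , fa))

OddWitness : Graph n → Vector Bool n → Set
OddWitness G X = ∃ λ v → X v ≡ false × X · adj G v ≡ true

Independent : Graph n → Vector Bool n → Set
Independent G A = ∀ X → X ⊆ᵇ A → Inhabited X → OddWitness G X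

clique : Subset n → Fin n → Fin n → Bool
clique K x y = lookup K x ∧ lookup K y

cliqueParity : (Fin k → Subset n) → Fin n → Fin n → Bool
cliqueParity C x y = sum (λ i → clique (C i) x y)

adj≡cliqueParity : (G : Graph n) (C : Fin k → Subset n) → IsBooleanSumOfCliques G C →
                   ∀ x y → x ≢ y → adj G x y ≡ cliqueParity C x y
adj≡cliqueParity G C isSum x y x≢y = ⇔-Odd⇒≡ (adj G x y) (λ i → clique (C i) x y) (isSum x y x≢y)

-- If X ⊆ A is a vanishing combination of the clique incidence vectors, then |N(v) ∩ X| is even for every v ∉ X.
independent≤cliques : (G : Graph n) (C : Fin k → Subset n) (A : Vector Bool n) →
                      IsBooleanSumOfCliques G C → Independent G A → count A ≤ k
independent≤cliques {n} {k} G C A isSum independent with count A ≤? k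
... | yes count≤k = count≤k
... | no  count≰k with linearlyDependent (λ a i → lookup (C i) a) A (≰⇒> count≰k)
...   | X , X⊆A , inhabited , vanishes with independent X X⊆A inhabited
...     | v , Xv , odd = contradiction (trans (sym odd) even) true≢false
  where
  open ≡-Reasoning
  c : Fin k → Fin n → Bool
  c i u = lookup (C i) u
  restrict : ∀ u → X u ∧ adj G v u ≡ X u ∧ cliqueParity C v u
  restrict u with X u in Xu
  ... | false = refl
  ... | true  = adj≡cliqueParity G C isSum v u (λ { refl → true≢false (trans (sym Xu) Xv) })
  even : X · adj G v ≡ false
  even = begin
    X · adj G v                                      ≡⟨ sum-cong-≗ restrict ⟩
    sum (λ u → X u ∧ sum (λ i → c i v ∧ c i u))      ≡⟨ sum-cong-≗ (λ u → *-distribˡ-sum (X u) (λ i → c i v ∧ c i u)) ⟩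
    sum (λ u → sum (λ i → X u ∧ (c i v ∧ c i u)))    ≡⟨ ∑-comm (λ u i → X u ∧ (c i v ∧ c i u)) ⟩
    sum (λ i → sum (λ u → X u ∧ (c i v ∧ c i u)))    ≡⟨ sum-cong-≗ (λ i → sum-cong-≗ (λ u → ∧-left-comm (X u) (c i v) (c i u))) ⟩
    sum (λ i → sum (λ u → c i v ∧ (X u ∧ c i u)))    ≡⟨ sum-cong-≗ (λ i → *-distribˡ-sum (c i v) (λ u → X u ∧ c i u)) ⟨
    sum (λ i → c i v ∧ X · c i)                      ≡⟨ sum-false _ (λ i → trans (cong (c i v ∧_) (vanishes i)) (∧-zeroʳ (c i v))) ⟩
    false                                            ∎
    where
    ∧-left-comm : ∀ a b d → a ∧ (b ∧ d) ≡ b ∧ (a ∧ d)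
    ∧-left-comm a b d = trans (sym (∧-assoc a b d)) (trans (cong (_∧ d) (∧-comm a b)) (∧-assoc b a d))

-- Star decompositions as Boolean sums of cliques

starEdge : Fin n → Subset n → Fin n → Fin n → Bool
starEdge c L x y = (δ c x ∧ lookup L y) ∨ (δ c y ∧ lookup L x)

starVertices : Fin n → Subset n → Subset n
starVertices c L = tabulate (λ u → δ c u ∨ lookup L u)

-- So a star with one leaf is a clique, and a larger star is the sum of two cliques.
clique-starVertices : (c : Fin n) (L : Subset n) → c ∉ L → ∀ x y → x ≢ y →
                      clique (starVertices c L) x y ≡ starEdge c L x y xor clique L x y
clique-starVertices c L c∉L x y x≢y
  rewrite lookup∘tabulate (λ u → δ c u ∨ lookup L u) x | lookup∘tabulate (λ u → δ c u ∨ lookup L u) y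
  with x ≟ c | y ≟ c
... | yes refl | yes refl = contradiction refl x≢y
... | yes refl | no _     rewrite ¬-not {lookup L x} (c∉L ∘ lookup⇒[]= x L) =
  sym (trans (xor-identityʳ _) (∨-identityʳ _))
... | no _     | yes refl rewrite ¬-not {lookup L y} (c∉L ∘ lookup⇒[]= y L) | ∧-zeroʳ (lookup L x) =
  trans (∧-identityʳ (lookup L x)) (sym (xor-identityʳ (lookup L x)))
... | no _     | no _     = refl

starWeight : ℕ → ℕ
starWeight 0             = 0
starWeight 1             = 1
starWeight (suc (suc _)) = 2

starCliques : (c : Fin n) (L : Subset n) → Vector (Subset n) (starWeight ∣ L ∣)
starCliques c L with ∣ L ∣
... | 0           = λ ()
... | 1           = λ _ → starVertices c L
... | suc (suc _) = λ { zero → starVertices c L ; (suc _) → L }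

cliqueParity-starCliques : (c : Fin n) (L : Subset n) → c ∉ L → ∀ x y → x ≢ y →
                           cliqueParity (starCliques c L) x y ≡ starEdge c L x y
cliqueParity-starCliques {n} c L c∉L x y x≢y with ∣ L ∣ in ∣L∣≡
... | 0 rewrite count≡0 (lookup L) (trans (sym (∣∣≡count L)) ∣L∣≡) x
              | count≡0 (lookup L) (trans (sym (∣∣≡count L)) ∣L∣≡) y
              | ∧-zeroʳ (δ c x) | ∧-zeroʳ (δ c y) = refl
... | 1 = begin
  clique V x y xor false                  ≡⟨ xor-identityʳ _ ⟩
  clique V x y                            ≡⟨ clique-starVertices c L c∉L x y x≢y ⟩
  starEdge c L x y xor clique L x y       ≡⟨ cong (starEdge c L x y xor_) single ⟩
  starEdge c L x y xor false              ≡⟨ xor-identityʳ _ ⟩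
  starEdge c L x y                        ∎
  where
  open ≡-Reasoning
  V : Subset n
  V = starVertices c L
  single : clique L x y ≡ false
  single = count≡1 (lookup L) (trans (sym (∣∣≡count L)) ∣L∣≡) x y x≢y
... | suc (suc _) = begin
  clique V x y xor (clique L x y xor false)   ≡⟨ cong (clique V x y xor_) (xor-identityʳ _) ⟩
  clique V x y xor clique L x y               ≡⟨ cong (_xor clique L x y) (clique-starVertices c L c∉L x y x≢y) ⟩
  (starEdge c L x y xor clique L x y) xor clique L x y ≡⟨ xor-assoc (starEdge c L x y) (clique L x y) (clique L x y) ⟩
  starEdge c L x y xor (clique L x y xor clique L x y) ≡⟨ cong (starEdge c L x y xor_) (xor-same (clique L x y)) ⟩
  starEdge c L x y xor false                  ≡⟨ xor-identityʳ _ ⟩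
  starEdge c L x y                            ∎
  where
  open ≡-Reasoning
  V : Subset n
  V = starVertices c L

totalStarWeight : (Fin k → Subset n) → ℕ
totalStarWeight {zero}  L = 0
totalStarWeight {suc k} L = starWeight ∣ L zero ∣ + totalStarWeight (L ∘ suc)

totalStarWeight≡ : (L : Fin k → Subset n) →
                   totalStarWeight L ≡ count (λ i → ∣ L i ∣ ≡ᵇ 1) + 2 * count (λ i → 1 <ᵇ ∣ L i ∣)
totalStarWeight≡ {zero}  L = refl
totalStarWeight≡ {suc k} L = begin
  starWeight ∣ L zero ∣ + totalStarWeight (L ∘ suc)   ≡⟨ cong₂ _+_ (starWeight≡ ∣ L zero ∣) (totalStarWeight≡ (L ∘ suc)) ⟩
  (isOne + 2 * isLarge) + (t + 2 * s)                 ≡⟨ regroup isOne isLarge t s ⟩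
  (isOne + t) + 2 * (isLarge + s)                     ∎
  where
  open ≡-Reasoning
  isOne isLarge t s : ℕ
  isOne   = if ∣ L zero ∣ ≡ᵇ 1 then 1 else 0
  isLarge = if 1 <ᵇ ∣ L zero ∣ then 1 else 0
  t = count (λ i → ∣ L (suc i) ∣ ≡ᵇ 1)
  s = count (λ i → 1 <ᵇ ∣ L (suc i) ∣)
  starWeight≡ : ∀ m → starWeight m ≡ (if m ≡ᵇ 1 then 1 else 0) + 2 * (if 1 <ᵇ m then 1 else 0)
  starWeight≡ 0             = refl
  starWeight≡ 1             = refl
  starWeight≡ (suc (suc _)) = refl
  regroup : ∀ a b t s → (a + 2 * b) + (t + 2 * s) ≡ (a + t) + 2 * (b + s)
  regroup = solve-∀

familyCliques : (Fin k → Fin n) → (L : Fin k → Subset n) → Vector (Subset n) (totalStarWeight L)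
familyCliques {zero}  c L = λ ()
familyCliques {suc k} c L = starCliques (c zero) (L zero) ++ familyCliques (c ∘ suc) (L ∘ suc)

cliqueParity-familyCliques : (c : Fin k → Fin n) (L : Fin k → Subset n) → (∀ j → c j ∉ L j) →
                             ∀ x y → x ≢ y → cliqueParity (familyCliques c L) x y ≡ sum (λ j → starEdge (c j) (L j) x y)
cliqueParity-familyCliques {zero}  c L c∉L x y x≢y = refl
cliqueParity-familyCliques {suc k} c L c∉L x y x≢y = begin
  cliqueParity (familyCliques c L) x y
    ≡⟨ sum-++ (λ K → clique K x y) (starCliques (c zero) (L zero)) (familyCliques (c ∘ suc) (L ∘ suc)) ⟩
  cliqueParity (starCliques (c zero) (L zero)) x y xor cliqueParity (familyCliques (c ∘ suc) (L ∘ suc)) x y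
    ≡⟨ cong₂ _xor_ (cliqueParity-starCliques (c zero) (L zero) (c∉L zero) x y x≢y)
                   (cliqueParity-familyCliques (c ∘ suc) (L ∘ suc) (c∉L ∘ suc) x y x≢y) ⟩
  sum (λ j → starEdge (c j) (L j) x y)
    ∎
  where open ≡-Reasoning

module _ {G : Graph n} (S : StarFamily G k) where

  starEdgeOf : Fin k → Fin n → Fin n → Bool
  starEdgeOf i = starEdge (centre S i) (leaves S i)

  starEdge⇒InStar : ∀ i x y → starEdgeOf i x y ≡ true → InStar S i x y
  starEdge⇒InStar i x y e with ∨-true e
  ... | inj₁ e₁ = let x≡c , Ly = ∧-true e₁ in inj₁ (δ≡true x≡c , lookup⇒[]= y (leaves S i) Ly)
  ... | inj₂ e₂ = let y≡c , Lx = ∧-true e₂ in inj₂ (δ≡true y≡c , lookup⇒[]= x (leaves S i) Lx)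

  InStar⇒starEdge : ∀ i x y → InStar S i x y → starEdgeOf i x y ≡ true
  InStar⇒starEdge i x y (inj₁ (refl , y∈L)) rewrite dec-true (x ≟ x) refl | []=⇒lookup y∈L = refl
  InStar⇒starEdge i x y (inj₂ (refl , x∈L)) rewrite dec-true (y ≟ y) refl | []=⇒lookup x∈L = ∨-zeroʳ _

  module _ (decomposition : IsStarDecomposition G S) where

    private
      leaves-adj : ∀ i x → x ∈ leaves S i → Edge G (centre S i) x
      leaves-adj = proj₁ (proj₂ decomposition)

      disjoint : ∀ i j → i ≢ j → ∀ x y → InStar S i x y → ¬ InStar S j x y
      disjoint = proj₁ (proj₂ (proj₂ decomposition))

      covers : ∀ x y → Edge G x y → ∃[ i ] InStar S i x y
      covers = proj₂ (proj₂ (proj₂ decomposition))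

    InStar⇒Edge : ∀ i x y → InStar S i x y → Edge G x y
    InStar⇒Edge i x y (inj₁ (refl , y∈L)) = leaves-adj i y y∈L
    InStar⇒Edge i x y (inj₂ (refl , x∈L)) = trans (adj-sym G x y) (leaves-adj i x x∈L)

    centre∉leaves : ∀ i → centre S i ∉ leaves S i
    centre∉leaves i c∈L = true≢false (trans (sym (leaves-adj i _ c∈L)) (irrefl G (centre S i)))

    adj≡starParity : ∀ x y → adj G x y ≡ sum (λ j → starEdgeOf j x y)
    adj≡starParity x y with adj G x y in xy
    ... | true  = let i , x~ᵢy = covers x y xy in
      sym (sum-single _ i (InStar⇒starEdge i x y x~ᵢy)
            (λ j j≢i → ¬-not (λ e → disjoint j i j≢i x y (starEdge⇒InStar j x y e) x~ᵢy)))
    ... | false = sym (sum-false _ (λ j → ¬-not (λ e →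
                    true≢false (trans (sym (InStar⇒Edge j x y (starEdge⇒InStar j x y e))) xy))))

    decomposition⇒cliques : Σ (Fin (tΣ S + 2 * sΣ S) → Subset n) (IsBooleanSumOfCliques G)
    decomposition⇒cliques =
      subst (λ d → Σ (Fin d → Subset n) (IsBooleanSumOfCliques G)) (totalStarWeight≡ (leaves S))
        (familyCliques (centre S) (leaves S) , λ x y x≢y →
          ≡⇒⇔-Odd (adj G x y) (λ i → clique (familyCliques (centre S) (leaves S) i) x y) (trans (adj≡starParity x y)
            (sym (cliqueParity-familyCliques (centre S) (leaves S) centre∉leaves x y x≢y))))

_∖_ : Graph n → Fin n → Graph n
G ∖ u = record
  { adj    = λ x y → adj G x y ∧ (not (δ u x) ∧ not (δ u y))
  ; sym    = λ x y → cong₂ _∧_ (adj-sym G x y) (∧-comm (not (δ u x)) (not (δ u y)))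
  ; irrefl = λ x → cong (_∧ (not (δ u x) ∧ not (δ u x))) (irrefl G x)
  }

module _ (G : Graph n) (u : Fin n) where

  ∖-isolated : ∀ x → adj (G ∖ u) u x ≡ false
  ∖-isolated x rewrite dec-true (u ≟ u) refl = ∧-zeroʳ (adj G u x)

  Edge-∖⁻ : ∀ {x y} → Edge (G ∖ u) x y → Edge G x y × x ≢ u × y ≢ u
  Edge-∖⁻ {x} {y} e with ∧-true e
  ... | xy , away with ∧-true away
  ...   | x-away , y-away = xy , avoids x-away , avoids y-away
    where
    avoids : ∀ {z} → not (δ u z) ≡ true → z ≢ u
    avoids {z} z-away refl = true≢false (trans (sym z-away) (cong not (dec-true (z ≟ z) refl)))

  Edge-∖⁺ : ∀ {x y} → Edge G x y → x ≢ u → y ≢ u → Edge (G ∖ u) x y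
  Edge-∖⁺ {x} {y} xy x≢u y≢u rewrite xy | dec-false (x ≟ u) x≢u | dec-false (y ≟ u) y≢u = refl

  ·-adj-∖ : (X : Vector Bool n) {w : Fin n} → w ≢ u → X u ≡ false → X · adj (G ∖ u) w ≡ X · adj G w
  ·-adj-∖ X {w} w≢u Xu = sum-cong-≗ pointwise
    where
    pointwise : ∀ x → X x ∧ adj (G ∖ u) w x ≡ X x ∧ adj G w x
    pointwise x with x ≟ u
    ... | yes refl rewrite Xu = refl
    ... | no  _    rewrite dec-false (w ≟ u) w≢u = cong (X x ∧_) (∧-identityʳ (adj G w x))

Acyclic-⊆ : {G H : Graph n} → (∀ x y → Edge H x y → Edge G x y) → Acyclic G → Acyclic H
Acyclic-⊆ H⊆G acyclic (k , f , injective , path , closing) =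
  acyclic (k , f , injective , (λ i → H⊆G _ _ (path i)) , H⊆G _ _ closing)

Acyclic-∖ : (G : Graph n) (u : Fin n) → Acyclic G → Acyclic (G ∖ u)
Acyclic-∖ G u = Acyclic-⊆ {G = G} {H = G ∖ u} (λ x y xy → proj₁ (Edge-∖⁻ G u {x} {y} xy))

·-isolated : (G : Graph n) (X : Vector Bool n) {w : Fin n} → (∀ x → adj G w x ≡ false) → X · adj G w ≡ false
·-isolated G X isolated = sum-false _ (λ x → trans (cong (X x ∧_) (isolated x)) (∧-zeroʳ (X x)))

record LeafAt (G : Graph n) (l v : Fin n) : Set where
  field
    edge   : Edge G l v
    unique : ∀ x → Edge G l x → x ≡ v

open LeafAt

module _ {G : Graph n} {l v : Fin n} (leaf : LeafAt G l v) where

  leaf≢ : l ≢ v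
  leaf≢ refl = true≢false (trans (sym (edge leaf)) (irrefl G l))

  Edge-leaf : Edge G v l
  Edge-leaf = trans (adj-sym G v l) (edge leaf)

  adj-leaf : ∀ x → adj G l x ≡ δ v x
  adj-leaf x with x ≟ v
  ... | yes refl = edge leaf
  ... | no x≢v   = ¬-not (x≢v ∘ unique leaf x)

  adj-towards-leaf : ∀ {w} → w ≢ v → adj G w l ≡ false
  adj-towards-leaf {w} w≢v = trans (adj-sym G w l) (trans (adj-leaf w) (dec-false (w ≟ v) w≢v))

  ·-leaf : (X : Vector Bool n) → X · adj G l ≡ X v
  ·-leaf X = trans (sum-cong-≗ (λ x → trans (cong (X x ∧_) (adj-leaf x)) (∧-comm (X x) (δ v x)))) (δ-· v X)

  leaf-isolated : ∀ x → adj (G ∖ v) l x ≡ false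
  leaf-isolated x rewrite adj-leaf x with x ≟ v
  ... | yes refl = ∧-zeroʳ (not (δ v l))
  ... | no  _    = refl

AtMostOneNeighbourBesides : Graph n → Fin n → Fin n → Set
AtMostOneNeighbourBesides G v l = ∀ x y → Edge G v x → Edge G v y → x ≢ l → y ≢ l → x ≡ y

-- Growing independent sets and star decompositions

oddWitness-untoggle : (G : Graph n) (X : Vector Bool n) {z w : Fin n} →
                      toggle X z w ≡ false → w ≢ z → toggle X z · adj G w ≡ true → adj G w z ≡ false →
                      OddWitness G X
oddWitness-untoggle G X {z} {w} Yw w≢z oddY wz =
  w , trans (sym (toggle-≢ X w≢z)) Yw , trans (·-untoggle X z (adj G w)) (cong₂ _xor_ oddY wz)

module _ (G : Graph n) (A : Vector Bool n) where

  isolated∉independent : ∀ {w} → (∀ x → adj G w x ≡ false) → Independent G A → A w ≡ false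
  isolated∉independent {w} isolated independent = ¬-not λ Aw →
    let v , _ , odd = independent (δ w) (λ x δx → subst (λ y → A y ≡ true) (sym (δ≡true δx)) Aw)
                                  (w , dec-true (w ≟ w) refl)
    in true≢false (trans (sym odd) (trans (δ-· w (adj G v)) (trans (adj-sym G v w) (isolated v))))

  lift-∖ : ∀ {u} → Independent (G ∖ u) A → ∀ X → X ⊆ᵇ A → Inhabited X → X u ≡ false →
           ∃ λ w → X w ≡ false × w ≢ u × X · adj G w ≡ true
  lift-∖ {u} independent X X⊆A inhabited Xu with independent X X⊆A inhabited
  ... | w , Xw , odd = w , Xw , w≢u , trans (sym (·-adj-∖ G u X w≢u Xu)) odd
    where
    w≢u : w ≢ u
    w≢u refl = true≢false (trans (sym odd) (·-isolated (G ∖ u) X (∖-isolated G u)))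

  oddWitness-∖ : ∀ {u} → Independent (G ∖ u) A → ∀ X → X ⊆ᵇ A → Inhabited X → X u ≡ false → OddWitness G X
  oddWitness-∖ independent X X⊆A inhabited Xu =
    let w , Xw , _ , odd = lift-∖ independent X X⊆A inhabited Xu in w , Xw , odd

-- A vertex v carrying two leaves l₁ and l₂: v and l₁ extend an independent set of G ∖ v.
module _ {G : Graph n} {v l₁ l₂ : Fin n} (leaf₁ : LeafAt G l₁ v) (leaf₂ : LeafAt G l₂ v) (l₁≢l₂ : l₁ ≢ l₂)
         {A′ : Vector Bool n} (independent′ : Independent (G ∖ v) A′) where

  private
    l₁≢v : l₁ ≢ v
    l₁≢v = leaf≢ leaf₁

    A′l₂ : A′ l₂ ≡ false
    A′l₂ = isolated∉independent (G ∖ v) A′ (leaf-isolated leaf₂) independent′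

    module _ (X : Vector Bool n) (X⊆A : X ⊆ᵇ toggle (toggle A′ v) l₁) (Xv : X v ≡ false) (Xl₁ : X l₁ ≡ true) where

      Y : Vector Bool n
      Y = toggle X l₁

      Yv : Y v ≡ false
      Yv = trans (toggle-≢ X (l₁≢v ∘ sym)) Xv

      Y⊆A′ : Y ⊆ᵇ A′
      Y⊆A′ = ⊆-toggle (⊆-toggle (λ x Yx → X⊆A x (toggle-⊆ X Xl₁ x Yx)) (trans (toggle-≡ X l₁) (cong not Xl₁))) Yv

      witness-Y-empty : ¬ Inhabited Y → OddWitness G X
      witness-Y-empty Y-empty = v , Xv , (begin
        X · adj G v                 ≡⟨ ·-untoggle X l₁ (adj G v) ⟩
        Y · adj G v xor adj G v l₁  ≡⟨ cong₂ _xor_ (sum-false _ Y∧≡false) (Edge-leaf leaf₁) ⟩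
        true                        ∎)
        where
        open ≡-Reasoning
        Y∧≡false : ∀ x → Y x ∧ adj G v x ≡ false
        Y∧≡false x = cong (_∧ adj G v x) (¬-not (λ Yx → Y-empty (x , Yx)))

      witness-Y-inhabited : Inhabited Y → OddWitness G X
      witness-Y-inhabited Y-inhabited with lift-∖ G A′ independent′ Y Y⊆A′ Y-inhabited Yv
      ... | w , Yw , w≢v , oddY = oddWitness-untoggle G X Yw w≢l₁ oddY (adj-towards-leaf leaf₁ w≢v)
        where
        w≢l₁ : w ≢ l₁
        w≢l₁ refl = true≢false (trans (sym oddY) (trans (·-leaf leaf₁ Y) Yv))

  count-twoLeaves : count (toggle (toggle A′ v) l₁) ≡ 2 + count A′
  count-twoLeaves =
    trans (count-toggle (toggle A′ v) l₁ (trans (toggle-≢ A′ l₁≢v) A′l₁))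
          (cong suc (count-toggle A′ v (isolated∉independent (G ∖ v) A′ (∖-isolated G v) independent′)))
    where
    A′l₁ : A′ l₁ ≡ false
    A′l₁ = isolated∉independent (G ∖ v) A′ (leaf-isolated leaf₁) independent′

  independent-twoLeaves : Independent G (toggle (toggle A′ v) l₁)
  independent-twoLeaves X X⊆A inhabited with X v in Xv | X l₁ in Xl₁
  ... | true  | _     = l₂ , ¬-not Xl₂≢true , trans (·-leaf leaf₂ X) Xv
    where
    Xl₂≢true : X l₂ ≢ true
    Xl₂≢true Xl₂ = true≢false (trans (sym (X⊆A l₂ Xl₂))
                     (trans (toggle-≢ (toggle A′ v) (l₁≢l₂ ∘ sym)) (trans (toggle-≢ A′ (leaf≢ leaf₂)) A′l₂)))
  ... | false | false = oddWitness-∖ G A′ independent′ X (⊆-toggle (⊆-toggle X⊆A Xl₁) Xv) inhabited Xv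
  ... | false | true with any? (λ x → toggle X l₁ x Bool.≟ true)
  ...   | no Y-empty      = witness-Y-empty X X⊆A Xv Xl₁ Y-empty
  ...   | yes Y-inhabited = witness-Y-inhabited X X⊆A Xv Xl₁ Y-inhabited

-- A leaf l at a vertex v of degree at most two: v, or l if v is already there, extends an independent set of G ∖ l.
module _ {G : Graph n} {l v : Fin n} (leaf : LeafAt G l v) (oneMore : AtMostOneNeighbourBesides G v l)
         {A′ : Vector Bool n} (independent′ : Independent (G ∖ l) A′) where

  private
    l≢v : l ≢ v
    l≢v = leaf≢ leaf

    A′l : A′ l ≡ false
    A′l = isolated∉independent (G ∖ l) A′ (∖-isolated G l) independent′

    independent-withCentre : A′ v ≡ false → Independent G (toggle A′ v)
    independent-withCentre A′v X X⊆A inhabited with X v in Xv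
    ... | true  = l , ¬-not Xl≢true , trans (·-leaf leaf X) Xv
      where
      Xl≢true : X l ≢ true
      Xl≢true Xl = true≢false (trans (sym (X⊆A l Xl)) (trans (toggle-≢ A′ l≢v) A′l))
    ... | false = oddWitness-∖ G A′ independent′ X X⊆A′ inhabited Xl
      where
      X⊆A′ : X ⊆ᵇ A′
      X⊆A′ = ⊆-toggle X⊆A Xv
      Xl : X l ≡ false
      Xl = ¬-not (λ Xl → true≢false (trans (sym (X⊆A′ l Xl)) A′l))

    module _ (A′v : A′ v ≡ true) (X : Vector Bool n) (X⊆A : X ⊆ᵇ toggle A′ l) (Xl : X l ≡ true) where

      Y : Vector Bool n
      Y = toggle X l

      Yl : Y l ≡ false
      Yl = trans (toggle-≡ X l) (cong not Xl)

      Y⊆A′ : Y ⊆ᵇ A′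
      Y⊆A′ = ⊆-toggle (λ x Yx → X⊆A x (toggle-⊆ X Xl x Yx)) Yl

      witness-v∈Y : Y v ≡ true → OddWitness G X
      witness-v∈Y Yv with lift-∖ G A′ independent′ Y Y⊆A′ (v , Yv) Yl
      ... | w , Yw , w≢l , oddY = oddWitness-untoggle G X Yw w≢l oddY (adj-towards-leaf leaf w≢v)
        where
        w≢v : w ≢ v
        w≢v refl = true≢false (trans (sym Yv) Yw)

      -- Otherwise Z = Y ∪ {v} ⊆ A′ has a witness w, and either w or v is a witness for X.
      witness-v∉Y : Y v ≡ false → OddWitness G X
      witness-v∉Y Yv with lift-∖ G A′ independent′ (toggle Y v) (toggle-⊆ᵇ Y⊆A′ A′v)
                            (v , trans (toggle-≡ Y v) (cong not Yv)) (trans (toggle-≢ Y l≢v) Yl)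
      ... | w , Zw , w≢l , oddZ with adj G w v in wv
      ...   | false = oddWitness-untoggle G X Yw w≢l oddY (adj-towards-leaf leaf w≢v)
        where
        w≢v : w ≢ v
        w≢v refl = true≢false (trans (sym (trans (toggle-≡ Y v) (cong not Yv))) Zw)
        Yw : Y w ≡ false
        Yw = trans (sym (toggle-≢ Y w≢v)) Zw
        oddY : Y · adj G w ≡ true
        oddY = trans (·-untoggle Y v (adj G w)) (cong₂ _xor_ oddZ wv)
      ...   | true = v , trans (sym (toggle-≢ X (l≢v ∘ sym))) Yv ,
                     sum-single _ l (cong₂ _∧_ Xl (Edge-leaf leaf)) onlyLeaf
        where
        w≢v : w ≢ v
        w≢v refl = true≢false (trans (sym wv) (irrefl G w))
        Xw : X w ≡ false
        Xw = trans (sym (toggle-≢ X w≢l)) (trans (sym (toggle-≢ Y w≢v)) Zw)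
        onlyLeaf : ∀ u → u ≢ l → X u ∧ adj G v u ≡ false
        onlyLeaf u u≢l with adj G v u in vu
        ... | false = ∧-zeroʳ (X u)
        ... | true  rewrite oneMore u w vu (trans (adj-sym G v w) wv) u≢l w≢l | Xw = refl

    independent-withLeaf : A′ v ≡ true → Independent G (toggle A′ l)
    independent-withLeaf A′v X X⊆A inhabited with X l in Xl
    ... | false = oddWitness-∖ G A′ independent′ X (⊆-toggle X⊆A Xl) inhabited Xl
    ... | true with toggle X l v in Yv
    ...   | true  = witness-v∈Y A′v X X⊆A Xl Yv
    ...   | false = witness-v∉Y A′v X X⊆A Xl Yv

  independent-pendant : ∃ λ A → Independent G A × count A ≡ suc (count A′)
  independent-pendant with A′ v in A′v
  ... | false = toggle A′ v , independent-withCentre A′v , count-toggle A′ v A′v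
  ... | true  = toggle A′ l , independent-withLeaf A′v , count-toggle A′ l A′l

InStar₁ : Fin n → Subset n → Fin n → Fin n → Set
InStar₁ c L x y = (x ≡ c × y ∈ L) ⊎ (y ≡ c × x ∈ L)

consStar : {G H : Graph n} → Fin n → Subset n → StarFamily H k → StarFamily G (suc k)
consStar c L S′ = record
  { centre = λ { zero → c ; (suc i) → centre S′ i }
  ; leaves = λ { zero → L ; (suc i) → leaves S′ i }
  }

extend-decomposition : {G : Graph n} (u c : Fin n) (L : Subset n) →
  Nonempty L → (∀ x → x ∈ L → Edge G c x) →
  (∀ x y → InStar₁ c L x y → x ≡ u ⊎ y ≡ u) →
  (∀ x y → Edge G x y → x ≡ u ⊎ y ≡ u → InStar₁ c L x y) →
  (S′ : StarFamily (G ∖ u) k) → IsStarDecomposition (G ∖ u) S′ →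
  IsStarDecomposition G (consStar c L S′)
extend-decomposition {k = k} {G = G} u c L nonempty leaves-adj star-at-u at-u-in-star S′
                     decomposition′@(nonempty′ , leaves-adj′ , disjoint′ , covers′) =
  nonemptyS , leaves-adjS , disjointS , coversS
  where
  S : StarFamily G (suc k)
  S = consStar c L S′
  avoids-u : ∀ j x y → InStar S′ j x y → ¬ (x ≡ u ⊎ y ≡ u)
  avoids-u j x y x~y at-u with Edge-∖⁻ G u (InStar⇒Edge S′ decomposition′ j x y x~y)
  ... | _ , x≢u , y≢u = [ x≢u , y≢u ]′ at-u
  nonemptyS : ∀ i → Nonempty (leaves S i)
  nonemptyS zero    = nonempty
  nonemptyS (suc i) = nonempty′ i
  leaves-adjS : ∀ i x → x ∈ leaves S i → Edge G (centre S i) x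
  leaves-adjS zero    = leaves-adj
  leaves-adjS (suc i) x x∈L = proj₁ (Edge-∖⁻ G u (leaves-adj′ i x x∈L))
  disjointS : ∀ i j → i ≢ j → ∀ x y → InStar S i x y → ¬ InStar S j x y
  disjointS zero    zero    i≢j = contradiction refl i≢j
  disjointS zero    (suc j) _   x y x~y x~ⱼy = avoids-u j x y x~ⱼy (star-at-u x y x~y)
  disjointS (suc i) zero    _   x y x~ᵢy x~y = avoids-u i x y x~ᵢy (star-at-u x y x~y)
  disjointS (suc i) (suc j) i≢j = disjoint′ i j (i≢j ∘ cong suc)
  coversS : ∀ x y → Edge G x y → ∃[ i ] InStar S i x y
  coversS x y xy with x ≟ u | y ≟ u
  ... | yes x≡u | _       = zero , at-u-in-star x y xy (inj₁ x≡u)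
  ... | no _    | yes y≡u = zero , at-u-in-star x y xy (inj₂ y≡u)
  ... | no x≢u  | no y≢u  = let i , x~ᵢy = covers′ x y (Edge-∖⁺ G u xy x≢u y≢u) in suc i , x~ᵢy

record Certificate (G : Graph n) : Set where
  field
    {size}         : ℕ
    stars          : StarFamily G size
    decomposition  : IsStarDecomposition G stars
    independentSet : Vector Bool n
    independent    : Independent G independentSet
    count≡weight   : count independentSet ≡ totalStarWeight (leaves stars)

certificate-edgeless : (G : Graph n) → (∀ x y → ¬ Edge G x y) → Certificate G
certificate-edgeless {n} G noEdge = record
  { size           = 0
  ; stars          = record { centre = λ () ; leaves = λ () }
  ; decomposition  = (λ ()) , (λ ()) , (λ ()) , λ x y xy → contradiction xy (noEdge x y)
  ; independentSet = λ _ → false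
  ; independent    = λ { X X⊆∅ (x , Xx) → contradiction (X⊆∅ x Xx) λ () }
  ; count≡weight   = count-∅ {n}
  }

certificate-twoLeaves : {G : Graph n} {v l₁ l₂ : Fin n} → LeafAt G l₁ v → LeafAt G l₂ v → l₁ ≢ l₂ →
                        Certificate (G ∖ v) → Certificate G
certificate-twoLeaves {n} {G} {v} {l₁} {l₂} leaf₁ leaf₂ l₁≢l₂ certificate′ = record
  { stars          = consStar v (N G v) stars
  ; decomposition  = extend-decomposition v v (N G v) (l₁ , ∈N (Edge-leaf leaf₁)) (λ x → N⇒Edge)
                       star-at-v at-v-in-star stars decomposition
  ; independentSet = toggle (toggle independentSet v) l₁
  ; independent    = independent-twoLeaves leaf₁ leaf₂ l₁≢l₂ independent
  ; count≡weight   = trans (count-twoLeaves leaf₁ leaf₂ l₁≢l₂ independent)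
                       (cong₂ _+_ (sym (starWeight-≥2 twoNeighbours)) count≡weight)
  }
  where
  open Certificate certificate′
  ∈N : ∀ {x} → Edge G v x → x ∈ N G v
  ∈N {x} vx = lookup⇒[]= x (N G v) (trans (lookup∘tabulate (adj G v) x) vx)
  N⇒Edge : ∀ {x} → x ∈ N G v → Edge G v x
  N⇒Edge {x} x∈N = trans (sym (lookup∘tabulate (adj G v) x)) ([]=⇒lookup x∈N)
  star-at-v : ∀ x y → InStar₁ v (N G v) x y → x ≡ v ⊎ y ≡ v
  star-at-v x y (inj₁ (x≡v , _)) = inj₁ x≡v
  star-at-v x y (inj₂ (y≡v , _)) = inj₂ y≡v
  at-v-in-star : ∀ x y → Edge G x y → x ≡ v ⊎ y ≡ v → InStar₁ v (N G v) x y
  at-v-in-star x y xy (inj₁ refl) = inj₁ (refl , ∈N xy)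
  at-v-in-star x y xy (inj₂ refl) = inj₂ (refl , ∈N (trans (adj-sym G y x) xy))
  twoNeighbours : 2 ≤ ∣ N G v ∣
  twoNeighbours = subst (2 ≤_) (sym (trans (∣∣≡count (N G v)) (count-cong (lookup∘tabulate (adj G v)))))
                    (count-two (adj G v) (Edge-leaf leaf₁) (Edge-leaf leaf₂) l₁≢l₂)
  starWeight-≥2 : ∀ {m} → 2 ≤ m → starWeight m ≡ 2
  starWeight-≥2 (s≤s (s≤s _)) = refl

certificate-pendant : {G : Graph n} {l v : Fin n} → LeafAt G l v → AtMostOneNeighbourBesides G v l →
                      Certificate (G ∖ l) → Certificate G
certificate-pendant {n} {G} {l} {v} leaf oneMore certificate′ = record
  { stars          = consStar v ⁅ l ⁆ stars
  ; decomposition  = extend-decomposition l v ⁅ l ⁆ (l , x∈⁅x⁆ l)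
                       (λ x x∈⁅l⁆ → subst (Edge G v) (sym (x∈⁅y⁆⇒x≡y l x∈⁅l⁆)) (Edge-leaf leaf))
                       star-at-l at-l-in-star stars decomposition
  ; independentSet = proj₁ (independent-pendant leaf oneMore independent)
  ; independent    = proj₁ (proj₂ (independent-pendant leaf oneMore independent))
  ; count≡weight   = trans (proj₂ (proj₂ (independent-pendant leaf oneMore independent)))
                       (cong₂ _+_ (cong starWeight (sym (∣⁅x⁆∣≡1 l))) count≡weight)
  }
  where
  open Certificate certificate′
  star-at-l : ∀ x y → InStar₁ v ⁅ l ⁆ x y → x ≡ l ⊎ y ≡ l
  star-at-l x y (inj₁ (_ , y∈⁅l⁆)) = inj₂ (x∈⁅y⁆⇒x≡y l y∈⁅l⁆)
  star-at-l x y (inj₂ (_ , x∈⁅l⁆)) = inj₁ (x∈⁅y⁆⇒x≡y l x∈⁅l⁆)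
  at-l-in-star : ∀ x y → Edge G x y → x ≡ l ⊎ y ≡ l → InStar₁ v ⁅ l ⁆ x y
  at-l-in-star x y xy (inj₁ refl) = inj₂ (unique leaf y xy , x∈⁅x⁆ l)
  at-l-in-star x y xy (inj₂ refl) = inj₁ (unique leaf x (trans (adj-sym G y x) xy) , x∈⁅x⁆ l)

-- Paths in forests

lastOf : Fin n → List (Fin n) → Fin n
lastOf x []       = x
lastOf _ (y ∷ ys) = lastOf y ys

-- For a position p of y in x ∷ xs, the initial segment x ∷ throughTail p of x ∷ xs ends at y.
throughTail : {x y : Fin n} {xs : List (Fin n)} → y ∈ₗ x ∷ xs → List (Fin n)
throughTail               (here _)  = []
throughTail {xs = x′ ∷ _} (there p) = x′ ∷ throughTail p

All-throughTail : {P : Fin n → Set} {x y : Fin n} {xs : List (Fin n)} →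
                  All P (x ∷ xs) → (p : y ∈ₗ x ∷ xs) → All P (x ∷ throughTail p)
All-throughTail              (px ∷ _)   (here _)  = px ∷ []
All-throughTail {xs = _ ∷ _} (px ∷ pxs) (there p) = px ∷ All-throughTail pxs p

Unique-throughTail : {x y : Fin n} {xs : List (Fin n)} →
                     Unique (x ∷ xs) → (p : y ∈ₗ x ∷ xs) → Unique (x ∷ throughTail p)
Unique-throughTail              _          (here _)  = [] ∷ []
Unique-throughTail {xs = _ ∷ _} (x∉ ∷ uxs) (there p) = All-throughTail x∉ p ∷ Unique-throughTail uxs p

Linked-throughTail : {R : Fin n → Fin n → Set} {x y : Fin n} {xs : List (Fin n)} →
                     Linked R (x ∷ xs) → (p : y ∈ₗ x ∷ xs) → Linked R (x ∷ throughTail p)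
Linked-throughTail              _         (here _)  = [-]
Linked-throughTail {xs = _ ∷ _} (r ∷ rxs) (there p) = r ∷ Linked-throughTail rxs p

lastOf-throughTail : {x y : Fin n} {xs : List (Fin n)} (p : y ∈ₗ x ∷ xs) → lastOf x (throughTail p) ≡ y
lastOf-throughTail              (here y≡x) = sym y≡x
lastOf-throughTail {xs = _ ∷ _} (there p)  = lastOf-throughTail p

lookup-injective : {xs : List (Fin n)} → Unique xs → ∀ {i j} → List.lookup xs i ≡ List.lookup xs j → i ≡ j
lookup-injective {xs = _ ∷ _}  _          {zero}  {zero}  _  = refl
lookup-injective {xs = _ ∷ xs} (x∉ ∷ _)   {zero}  {suc j} eq = contradiction eq (All.lookup x∉ (∈-lookup {xs = xs} j))
lookup-injective {xs = _ ∷ xs} (x∉ ∷ _)   {suc i} {zero}  eq = contradiction (sym eq) (All.lookup x∉ (∈-lookup {xs = xs} i))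
lookup-injective {xs = _ ∷ _}  (_ ∷ uxs)  {suc i} {suc j} eq = cong suc (lookup-injective uxs eq)

Unique⇒length≤ : {xs : List (Fin n)} → Unique xs → length xs ≤ n
Unique⇒length≤ u = injective⇒≤ (lookup-injective u)

module _ (G : Graph n) where

  Linked-lookup : {x : Fin n} {xs : List (Fin n)} → Linked (Edge G) (x ∷ xs) →
                  ∀ (i : Fin (length xs)) → Edge G (List.lookup (x ∷ xs) (inject₁ i)) (List.lookup (x ∷ xs) (suc i))
  Linked-lookup (e ∷ _)  zero    = e
  Linked-lookup (_ ∷ es) (suc i) = Linked-lookup es i

  lookup-last : (x : Fin n) (xs : List (Fin n)) → List.lookup (x ∷ xs) (fromℕ (length xs)) ≡ lastOf x xs
  lookup-last x []       = refl
  lookup-last x (y ∷ ys) = lookup-last y ys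

  pathCycle : {a b c : Fin n} {cs : List (Fin n)} → Unique (a ∷ b ∷ c ∷ cs) → Linked (Edge G) (a ∷ b ∷ c ∷ cs) →
              Edge G (lastOf c cs) a → Cycle G
  pathCycle {a} {b} {c} {cs} u ℓ closing =
    length cs , List.lookup (a ∷ b ∷ c ∷ cs) , lookup-injective u , Linked-lookup ℓ ,
    subst (λ z → Edge G z a) (sym (lookup-last c cs)) closing

  noChord : Acyclic G → {a b y : Fin n} {xs : List (Fin n)} →
            Unique (a ∷ b ∷ xs) → Linked (Edge G) (a ∷ b ∷ xs) → y ∈ₗ xs → ¬ Edge G a y
  noChord acyclic {xs = c ∷ cs} ((a≢b ∷ a∉) ∷ b∉ ∷ u) (ab ∷ bc ∷ ℓ) p ay =
    acyclic (pathCycle ((a≢b ∷ All-throughTail a∉ p) ∷ All-throughTail b∉ p ∷ Unique-throughTail u p)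
                       (ab ∷ bc ∷ Linked-throughTail ℓ p)
                       (subst (λ z → Edge G z _) (sym (lastOf-throughTail p)) (trans (adj-sym G _ _) ay)))

data LeafConfiguration (G : Graph n) : Set where
  twoLeaves : ∀ {v l₁ l₂} → LeafAt G l₁ v → LeafAt G l₂ v → l₁ ≢ l₂ → LeafConfiguration G
  pendant   : ∀ {l v} → LeafAt G l v → AtMostOneNeighbourBesides G v l → LeafConfiguration G

module _ (G : Graph n) (acyclic : Acyclic G) where

  open import Data.List.Membership.DecPropositional (_≟_ {n}) using (_∈?_)

  private
    neighbourBesides? : ∀ x y → Dec (∃ λ z → Edge G x z × z ≢ y)
    neighbourBesides? x y = any? (λ z → (adj G x z Bool.≟ true) ×-dec ¬? (z ≟ y))

    neighbourOff? : ∀ x xs → Dec (∃ λ z → Edge G x z × z ∉ₗ xs)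
    neighbourOff? x xs = any? (λ z → (adj G x z Bool.≟ true) ×-dec ¬? (z ∈? xs))

    leafAt : ∀ {l v} → Edge G l v → ¬ (∃ λ z → Edge G l z × z ≢ v) → LeafAt G l v
    leafAt {l} {v} lv noOther =
      record { edge = lv ; unique = λ z lz → decidable-stable (z ≟ v) (λ z≢v → noOther (z , lz , z≢v)) }

    irrefl≢ : ∀ {x y} → Edge G x y → y ≢ x
    irrefl≢ {x} xy refl = true≢false (trans (sym xy) (irrefl G x))

    extendPath : ∀ {y x₀ x₁ xs} → Unique (x₀ ∷ x₁ ∷ xs) → Linked (Edge G) (x₀ ∷ x₁ ∷ xs) →
                 Edge G x₀ y → y ≢ x₁ → Unique (y ∷ x₀ ∷ x₁ ∷ xs) × Linked (Edge G) (y ∷ x₀ ∷ x₁ ∷ xs)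
    extendPath {y} {x₀} {xs = xs} u ℓ x₀y y≢x₁ =
      (irrefl≢ x₀y ∷ y≢x₁ ∷ ¬Any⇒All¬ xs (λ y∈xs → noChord G acyclic u ℓ y∈xs x₀y)) ∷ u ,
      trans (adj-sym G y x₀) x₀y ∷ ℓ

    onPath-unique : ∀ {x z z′ xs} → Unique (x ∷ xs) → Linked (Edge G) (x ∷ xs) →
                    Edge G x z → z ∈ₗ xs → Edge G x z′ → z′ ∈ₗ xs → z ≡ z′
    onPath-unique u ℓ _  (here z≡c) _   (here z′≡c) = trans z≡c (sym z′≡c)
    onPath-unique u ℓ xz (there p)  _   _           = contradiction xz (noChord G acyclic u ℓ p)
    onPath-unique u ℓ _  (here _)   xz′ (there p′)  = contradiction xz′ (noChord G acyclic u ℓ p′)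

  -- Extend the path x₀ x₁ … at x₀ for as long as possible, replacing x₀ by a path z y when x₀ is a leaf and x₁
  -- has a neighbour y off the path that is not a leaf; as for a longest path, its end then forms a configuration.
  -- Paths have at most n vertices.
  search : ∀ fuel (x₀ x₁ : Fin n) xs → Unique (x₀ ∷ x₁ ∷ xs) → Linked (Edge G) (x₀ ∷ x₁ ∷ xs) →
           n ≤ fuel + length xs → LeafConfiguration G
  searchAtLeaf : ∀ fuel (x₀ x₁ : Fin n) xs → Unique (x₀ ∷ x₁ ∷ xs) → Linked (Edge G) (x₀ ∷ x₁ ∷ xs) →
                 n ≤ suc fuel + length xs → LeafAt G x₀ x₁ → LeafConfiguration G

  search zero x₀ x₁ xs u ℓ bound = contradiction (≤-trans bound (n≤1+n _)) (<⇒≱ (Unique⇒length≤ u))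
  search (suc fuel) x₀ x₁ xs u ℓ bound with neighbourBesides? x₀ x₁
  ... | yes (y , x₀y , y≢x₁) = let u′ , ℓ′ = extendPath u ℓ x₀y y≢x₁ in
                               search fuel y x₀ (x₁ ∷ xs) u′ ℓ′ (subst (n ≤_) (sym (+-suc fuel (length xs))) bound)
  ... | no x₀-leaf           = searchAtLeaf fuel x₀ x₁ xs u ℓ bound (leafAt (Linked.head ℓ) x₀-leaf)

  searchAtLeaf fuel x₀ x₁ xs u ℓ bound leaf₀ with neighbourOff? x₁ (x₀ ∷ xs)
  ... | no onPath = pendant leaf₀ atMostOne
    where
    onPath′ : ∀ {z} → Edge G x₁ z → z ≢ x₀ → z ∈ₗ xs
    onPath′ {z} x₁z z≢x₀ with decidable-stable (z ∈? (x₀ ∷ xs)) (λ z∉ → onPath (z , x₁z , z∉))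
    ... | here z≡x₀  = contradiction z≡x₀ z≢x₀
    ... | there z∈xs = z∈xs
    atMostOne : AtMostOneNeighbourBesides G x₁ x₀
    atMostOne x y x₁x x₁y x≢x₀ y≢x₀ =
      onPath-unique (AllPairs.tail u) (Linked.tail ℓ) x₁x (onPath′ x₁x x≢x₀) x₁y (onPath′ x₁y y≢x₀)
  ... | yes (y , x₁y , y∉) with neighbourBesides? y x₁
  ...   | no y-leaf = twoLeaves leaf₀ (leafAt (trans (adj-sym G y x₁) x₁y) y-leaf) (λ { refl → y∉ (here refl) })
  ...   | yes (z , yz , z≢x₁) =
    let u′ , ℓ′ = extendPath u₁ ℓ₁ yz z≢x₁
    in search fuel z y (x₁ ∷ xs) u′ ℓ′ (subst (n ≤_) (sym (+-suc fuel (length xs))) bound)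
    where
    u₁ : Unique (y ∷ x₁ ∷ xs)
    u₁ = (irrefl≢ x₁y ∷ All.tail (¬Any⇒All¬ (x₀ ∷ xs) y∉)) ∷ AllPairs.tail u
    ℓ₁ : Linked (Edge G) (y ∷ x₁ ∷ xs)
    ℓ₁ = trans (adj-sym G y x₁) x₁y ∷ Linked.tail ℓ

  leafConfiguration : ∀ {a b} → Edge G a b → LeafConfiguration G
  leafConfiguration {a} {b} ab =
    search n a b [] ((irrefl≢ ab ∘ sym ∷ []) ∷ [] ∷ []) (ab ∷ [-]) (m≤m+n n 0)

-- U contains every vertex that still has an edge; deleting the edges at a vertex of U removes it from U.
certificate : ∀ m (G : Graph n) (U : Vector Bool n) → Acyclic G → (∀ x y → Edge G x y → U x ≡ true) →
              count U ≤ m → Certificate G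
certificate zero G U acyclic covered bound =
  certificate-edgeless G (λ x y xy → contradiction (subst (_≤ 0) (count-untoggle U x (covered x y xy)) bound) λ ())
certificate (suc m) G U acyclic covered bound with any? (λ x → any? (λ y → adj G x y Bool.≟ true))
... | no noEdge        = certificate-edgeless G (λ x y xy → noEdge (x , y , xy))
... | yes (_ , _ , ab) = fromConfiguration (leafConfiguration G acyclic ab)
  where
  recurse : ∀ u {w} → Edge G u w → Certificate (G ∖ u)
  recurse u {w} uw = certificate m (G ∖ u) (toggle U u) (Acyclic-∖ G u acyclic) covered′
                       (≤-pred (subst (_≤ suc m) (count-untoggle U u (covered u w uw)) bound))
    where
    covered′ : ∀ x y → Edge (G ∖ u) x y → toggle U u x ≡ true
    covered′ x y xy = let xy′ , x≢u , _ = Edge-∖⁻ G u xy in trans (toggle-≢ U x≢u) (covered x y xy′)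
  fromConfiguration : LeafConfiguration G → Certificate G
  fromConfiguration (twoLeaves leaf₁ leaf₂ l₁≢l₂) =
    certificate-twoLeaves leaf₁ leaf₂ l₁≢l₂ (recurse _ (Edge-leaf leaf₁))
  fromConfiguration (pendant leaf oneMore) =
    certificate-pendant leaf oneMore (recurse _ (edge leaf))

forestCertificate : (G : Graph n) → Acyclic G → Certificate G
forestCertificate G acyclic = certificate _ G (λ _ → true) acyclic (λ _ _ _ → refl) ≤-refl

module _ (G : Graph n) where

  Odd-∣N∩∣⇔ : ∀ v (X : Subset n) → Odd ∣ N G v ∩ X ∣ ⇔ lookup X · adj G v ≡ true
  Odd-∣N∩∣⇔ v X =
    subst (λ m → Odd m ⇔ lookup X · adj G v ≡ true) (sym ∣N∩X∣≡) (Odd-count⇔sum (λ u → lookup X u ∧ adj G v u))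
    where
    ∣N∩X∣≡ : ∣ N G v ∩ X ∣ ≡ count (λ u → lookup X u ∧ adj G v u)
    ∣N∩X∣≡ = trans (∣∣≡count (N G v ∩ X)) (count-cong λ u →
               trans (lookup-zipWith _∧_ u (N G v) X) (trans (cong (_∧ lookup X u) (lookup∘tabulate (adj G v) u))
                 (∧-comm (adj G v u) (lookup X u))))

  Independent⇒IndependentMod2 : (A : Vector Bool n) → Independent G A → IndependentMod2 G (tabulate A)
  Independent⇒IndependentMod2 A independent X X⊆A (x , x∈X) =
    let v , Xv , odd = independent (lookup X) X⊆ᵇA (x , []=⇒lookup x∈X)
    in v , (λ v∈X → true≢false (trans (sym ([]=⇒lookup v∈X)) Xv)) , Equivalence.from (Odd-∣N∩∣⇔ v X) odd
    where
    X⊆ᵇA : lookup X ⊆ᵇ A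
    X⊆ᵇA y Xy = trans (sym (lookup∘tabulate A y)) ([]=⇒lookup (X⊆A (lookup⇒[]= y X Xy)))

  IndependentMod2⇒Independent : (A : Subset n) → IndependentMod2 G A → Independent G (lookup A)
  IndependentMod2⇒Independent A independent X X⊆A (x , Xx) =
    let v , v∉X , odd = independent (tabulate X) X⊆A′ (x , ∈X Xx)
    in v , ¬-not (v∉X ∘ ∈X) ,
       trans (sum-cong-≗ (λ u → cong (_∧ adj G v u) (sym (lookup∘tabulate X u))))
             (Equivalence.to (Odd-∣N∩∣⇔ v (tabulate X)) odd)
    where
    ∈X : ∀ {y} → X y ≡ true → y ∈ tabulate X
    ∈X {y} Xy = lookup⇒[]= y (tabulate X) (trans (lookup∘tabulate X y) Xy)
    X⊆A′ : tabulate X ⊆ A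
    X⊆A′ {y} y∈X = lookup⇒[]= y A (X⊆A y (trans (sym (lookup∘tabulate X y)) ([]=⇒lookup y∈X)))

  ∣independentMod2∣≤cliques : (C : Fin k → Subset n) → IsBooleanSumOfCliques G C →
                              (A : Subset n) → IndependentMod2 G A → ∣ A ∣ ≤ k
  ∣independentMod2∣≤cliques C isSum A independent =
    subst (_≤ _) (sym (∣∣≡count A)) (independent≤cliques G C (lookup A) isSum (IndependentMod2⇒Independent A independent))

∣tabulate∣≡count : (A : Vector Bool n) → ∣ tabulate A ∣ ≡ count A
∣tabulate∣≡count A = trans (∣∣≡count (tabulate A)) (count-cong (lookup∘tabulate A))

mainTheorem1 : ∀ {n} (T : Graph n) → IsTree T →
    ∃[ d ] (IsInd T d × IsBoolDim T d × IsM T d)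
mainTheorem1 {n} T (_ , _ , acyclic) = d , isInd , isBoolDim , isM
  where
  open Certificate (forestCertificate T acyclic)
  d : ℕ
  d = tΣ stars + 2 * sΣ stars
  count≡d : count independentSet ≡ d
  count≡d = trans count≡weight (totalStarWeight≡ (leaves stars))
  cliques : Σ (Fin d → Subset n) (IsBooleanSumOfCliques T)
  cliques = decomposition⇒cliques stars decomposition
  d≤cliques : ∀ {k} (C : Fin k → Subset n) → IsBooleanSumOfCliques T C → d ≤ k
  d≤cliques C isSum = subst (_≤ _) count≡d (independent≤cliques T C independentSet isSum independent)
  isInd : IsInd T d
  isInd = (tabulate independentSet , Independent⇒IndependentMod2 T independentSet independent ,
           trans (∣tabulate∣≡count independentSet) count≡d)
        , ∣independentMod2∣≤cliques T (proj₁ cliques) (proj₂ cliques)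
  isBoolDim : IsBoolDim T d
  isBoolDim = cliques , λ _ → d≤cliques
  isM : IsM T d
  isM = (size , stars , decomposition , refl) ,
        λ _ S decompositionS → uncurry d≤cliques (decomposition⇒cliques S decompositionS)
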